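{- Let $P$ be a $k$-regular tilable contractible polycell ($P$ not necessarily full). Then there exists a maximal tiling $Q$ of $P$.
   Context: Let $G$ be a simple directed graph (no loops, no multiple edges, and if $(v,v')$ is an edge then $(v',v)$ is not). Fix a set $\Theta$ of elementary directed circuits of $G$, called cells. A polycell $P$ is a set of cells of $\Theta$; the edges (resp. vertices) of $P$ are those of its cells. $P$ is $k$-regular if every cell of $P$ is a circuit of length $k$. The boundary $\partial P$ is an arbitrarily distinguished set of edges of $P$; a vertex is on the boundary if it is an endpoint of an edge of $\partial P$. $P$ is full if the undirected graph formed by the edges of $\partial P$ is connected. It is assumed that any set of cells of $P$ has at most one edge in common. For an edge $e$ of $P$ not in $\partial P$, the set of all cells of $P$ containing $e$ is a tile. A tiling of $P$ is a partition of the cells of $P$ into tiles; $P$ is tilable if it has a tiling; for a tile $t$ of a tiling $Q$ the unique edge common to the cells of $t$ is a tiling edge of $Q$. A flow on $P$ is a map from edges of $P$ to $\mathbb{Z}$. A travel from $s$ to $s'$ is a set of edges of $P$ forming, orientations forgotten, a path from $s$ to $s'$; it is closed if it forms a cycle. The flux of $C$ on $T$ is $F_T(C)=\sum_{e\in T^+}C(e)-\sum_{e\in T^- }C(e)$ with $T^+$ (resp. $T^-$) the edges traversed along (resp. against) their direction. For a cell $c$, $T_c$ is the closed travel around $c$. $C$ is a tension if $F_T(C)=0$ for all closed travels $T$ in $P$. $P$ has a balanced boundary if, for a flow $C$ with $C(e)=1$ on $\partial P$, $F_T(C)=0$ for every closed travel $T$ made of edges of $\partial P$. $P$ is contractible if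 it has a balanced boundary and a flow $C$ on $P$ is a tension iff $F_{T_c}(C)=0$ for all cells $c$ of $P$. For a tiling $Q$ of a $k$-regular $P$, $C_Q(e)=1-k$ if $e$ is a tiling edge of $Q$ and $C_Q(e)=1$ otherwise; for $P$ contractible this is a tension. Fix a distinguished vertex $\nu$ on the boundary of $P$. The height function $\varphi_Q$ of $Q$ is the potential of $C_Q$: $\varphi_Q(\nu)=0$ and $\varphi_Q(y)-\varphi_Q(x)=F_{T}(C_Q)$ for any travel $T$ from $x$ to $y$ (vertices of $P$). With $h$ the maximum of $\varphi_Q$ over the vertices of $P$, $Q$ is a maximal tiling if all vertices $x$ with $\varphi_Q(x)=h$ are on the boundary of $P$. -}

module Defs where

open import Data.Nat using (ℕ; _≤_)
open import Data.Fin using (Fin; _≟_)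
open import Data.Fin.Properties using () renaming (_≟_ to _≟ᶠ_)
open import Data.Integer using (ℤ; +_; -_; _-_) renaming (_+_ to _+ℤ_; _≤_ to _≤ℤ_)
open import Data.List using (List; []; _∷_; _++_; map; length; lookup; concatMap)
open import Data.List.Membership.Propositional using (_∈_; _∉_)
open import Data.List.Relation.Binary.Subset.Propositional using (_⊆_)
open import Data.List.Relation.Unary.All using (All)
open import Data.List.Relation.Unary.Any using (Any)
open import Data.List.Relation.Unary.Unique.Propositional using (Unique)
open import Data.Product using (Σ; ∃; _×_; _,_; proj₂)
open import Data.Product.Properties using (≡-dec)
open import Data.Sum using (_⊎_)
open import Data.Bool using (if_then_else_)
open import Relation.Nullary using (¬_; does)
open import Relation.Binary.PropositionalEquality using (_≡_; _≢_)
import Data.List.Membership.DecPropositional as DecMem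

Edge : ℕ → Set
Edge n = Fin n × Fin n

-- A cell (elementary directed circuit) is given by its list of vertices
-- v₀ v₁ … v_{m-1}; its edges are (v₀,v₁), …, (v_{m-2},v_{m-1}), (v_{m-1},v₀).
cellEdges : ∀ {n} → List (Fin n) → List (Edge n)
cellEdges {n} [] = []
cellEdges {n} (v ∷ vs) = go (v ∷ vs)
  where
  go : List (Fin n) → List (Edge n)
  go [] = []
  go (a ∷ []) = (a , v) ∷ []
  go (a ∷ b ∷ r) = (a , b) ∷ go (b ∷ r)

record Polycell (n : ℕ) : Set where
  field
    GE       : List (Edge n)
    noLoop   : ∀ {u v} → (u , v) ∈ GE → u ≢ v
    antisym  : ∀ {u v} → (u , v) ∈ GE → (v , u) ∉ GE
    cells    : List (List (Fin n))
    cellNonEmpty  : All (λ c → 1 ≤ length c) cells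
    cellElementary : All Unique cells
    cellInG  : All (λ c → cellEdges c ⊆ GE) cells
    atMostOneCommon : (i j : Fin (length cells)) → i ≢ j →
      ∀ {e e'} → e ∈ cellEdges (lookup cells i) → e ∈ cellEdges (lookup cells j) →
                 e' ∈ cellEdges (lookup cells i) → e' ∈ cellEdges (lookup cells j) →
                 e ≡ e'
    boundary : List (Edge n)
    boundary⊆ : boundary ⊆ concatMap cellEdges cells

module _ {n : ℕ} (P : Polycell n) where
  open Polycell P

  edgesP : List (Edge n)
  edgesP = concatMap cellEdges cells

  VertexP : Fin n → Set
  VertexP x = Any (λ c → x ∈ c) cells

  OnBoundary : Fin n → Set
  OnBoundary x = ∃ λ y → ((x , y) ∈ boundary) ⊎ ((y , x) ∈ boundary)

  Regular : ℕ → Set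
  Regular k = All (λ c → length c ≡ k) cells

Flow : ℕ → Set
Flow n = Edge n → ℤ

data Dir : Set where
  fwd bwd : Dir

-- A walk from x to z using edges of E, orientation forgotten: a start vertex
-- and a list of steps (direction, next vertex).
data Walk {n : ℕ} (E : List (Edge n)) : Fin n → List (Dir × Fin n) → Fin n → Set where
  nil  : ∀ {x} → Walk E x [] x
  stepF : ∀ {x y ts z} → (x , y) ∈ E → Walk E y ts z → Walk E x ((fwd , y) ∷ ts) z
  stepB : ∀ {x y ts z} → (y , x) ∈ E → Walk E y ts z → Walk E x ((bwd , y) ∷ ts) z

Travel : ∀ {n} → List (Edge n) → Fin n → List (Dir × Fin n) → Fin n → Set
Travel E x ts y = Walk E x ts y × Unique (x ∷ map proj₂ ts)

ClosedTravel : ∀ {n} → List (Edge n) → Fin n → List (Dir × Fin n) → Set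
ClosedTravel E x ts = Walk E x ts x × Unique (map proj₂ ts) × (3 ≤ length ts)

flux : ∀ {n} → Flow n → Fin n → List (Dir × Fin n) → ℤ
flux C x [] = + 0
flux C x ((fwd , y) ∷ ts) = C (x , y) +ℤ flux C y ts
flux C x ((bwd , y) ∷ ts) = (- C (y , x)) +ℤ flux C y ts

cellFlux : ∀ {n} → Flow n → List (Fin n) → ℤ
cellFlux C [] = + 0
cellFlux C (v ∷ vs) = flux C v (map (λ w → (fwd , w)) (vs ++ v ∷ []))

module _ {n : ℕ} (P : Polycell n) where
  open Polycell P

  IsTension : Flow n → Set
  IsTension C = ∀ x ts → ClosedTravel (edgesP P) x ts → flux C x ts ≡ + 0

  BalancedBoundary : Set
  BalancedBoundary = ∀ x ts → ClosedTravel boundary x ts → flux (λ _ → + 1) x ts ≡ + 0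

  Contractible : Set
  Contractible = BalancedBoundary ×
    (∀ (C : Flow n) → (IsTension C → All (λ c → cellFlux C c ≡ + 0) cells)
                    × (All (λ c → cellFlux C c ≡ + 0) cells → IsTension C))

  -- A tiling, given by its set of tiling edges: each is an edge of P not on
  -- the boundary, and the tiles (cells containing a given tiling edge) form a
  -- partition of the cells, i.e. every cell contains exactly one tiling edge.
  record Tiling : Set where
    field
      tedges   : List (Edge n)
      tedgesP  : ∀ {e} → e ∈ tedges → e ∈ edgesP P
      tedges∂  : ∀ {e} → e ∈ tedges → e ∉ boundary
      cover    : All (λ c → ∃ λ e → e ∈ tedges × e ∈ cellEdges c) cells
      disjoint : All (λ c → ∀ {e e'} → e ∈ tedges → e ∈ cellEdges c →
                                        e' ∈ tedges → e' ∈ cellEdges c → e ≡ e') cells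

  Tilable : Set
  Tilable = Tiling

  C[_] : ℕ → Tiling → Flow n
  C[ k ] Q e = if does (e ∈? Tiling.tedges Q) then (+ 1) - (+ k) else + 1
    where open DecMem (≡-dec _≟ᶠ_ _≟ᶠ_) using (_∈?_)

  IsHeight : Fin n → ℕ → Tiling → (Fin n → ℤ) → Set
  IsHeight ν k Q φ = (φ ν ≡ + 0) ×
    (∀ x ts y → Travel (edgesP P) x ts y → φ y - φ x ≡ flux (C[ k ] Q) x ts)

  Maximal : Fin n → ℕ → Tiling → Set
  Maximal ν k Q = ∃ λ (φ : Fin n → ℤ) → IsHeight ν k Q φ ×
    (∀ x → VertexP P x → (∀ y → VertexP P y → φ y ≤ℤ φ x) → OnBoundary P x)

-- A tiling Q gives a flow C_Q with zero flux around every cell, so by contractibility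
-- C_Q is a tension.  In a simple graph a tension has zero flux along every closed walk
-- (cut the walk at a repeated vertex; what remains are simple cycles and back-and-forth
-- steps), hence it has a potential, the height function φ_Q, obtained by spreading values
-- along edges one connected component at a time.
-- If φ_Q attains its maximum at a vertex x off the boundary, every edge leaving x is a
-- tiling edge (an untiled one would climb above the maximum) and no edge entering x is.
-- Replacing, in each cell through x, the tiling edge leaving x by the edge entering x
-- gives a new tiling whose height function is φ_Q lowered by k at x.  As φ_Q(x) ≥ φ_Q(ν) = 0,
-- heights never drop below min(φ_Q₀, −k), so the total height strictly decreases along
-- these flips and they end in a maximal tiling.

module Submission where

open import Defs
open import Data.Nat using (ℕ; suc; z≤n; s≤s; s≤s⁻¹) renaming (_≤_ to _≤ℕ_; _<_ to _<ℕ_)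
import Data.Nat as ℕ
import Data.Nat.Properties as ℕₚ
open import Data.Nat.Properties using (m≤m+n; m<n+m; ≤-refl; <-≤-trans)
open import Data.Nat.ListAction using (sum)
open import Data.Fin using (Fin; _≟_)
open import Data.Fin.Properties using () renaming (any? to anyFin?; all? to allFin?)
open import Data.Integer using (ℤ; 0ℤ; +_; _+_; _-_; -_; _≤_; _<_; +≤+; -<+; ∣_∣)
import Data.Integer.Properties as ℤₚ
open import Data.Integer.Properties
  using (+-identityˡ; +-identityʳ; +-assoc; +-inverseʳ; i≤j⇒i-j≤0; i≤j⇒0≤j-i; 0≤i⇒+∣i∣≡i; drop‿+≤+; drop‿+<+; i-j≤i)
open import Data.Integer.Tactic.RingSolver using (solve-∀)
open import Data.List using (List; []; _∷_; _++_; _∷ʳ_; map; length; drop; filter; allFin; concatMap)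
open import Data.List.Properties using (length-map; length-++; ++-assoc; filter-notAll)
open import Data.List.Extrema ℤₚ.≤-totalOrder using (min; min≤⊤; min≤xs)
open import Data.List.Membership.Propositional using (_∈_; _∉_; find; lose)
open import Data.List.Membership.Propositional.Properties
  using (∈-map⁺; ∈-map⁻; ∈-∃++; ∈-filter⁺; ∈-filter⁻; ∈-++⁺ˡ; ∈-++⁺ʳ; ∈-++⁻; ∈-allFin; ∈-concatMap⁺; ∈-concatMap⁻)
import Data.List.Membership.DecPropositional as DecMembership
open import Data.List.Relation.Unary.Any as Any using (here; there; any?)
open import Data.List.Relation.Unary.All as All using (All; []; _∷_)
open import Data.List.Relation.Unary.All.Properties using (map⁻; map⁺; ¬Any⇒All¬; ¬All⇒Any¬)
open import Data.List.Relation.Unary.AllPairs using ([]; _∷_)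
open import Data.List.Relation.Unary.Unique.Propositional using (Unique)
import Data.List.Relation.Unary.Unique.Propositional.Properties as Unique
open import Data.List.Relation.Binary.Permutation.Propositional using (↭-sym; ↭⇒↭ₛ)
open import Data.List.Relation.Binary.Permutation.Propositional.Properties using (∷↭∷ʳ; ∈-resp-↭)
open import Data.List.Relation.Binary.Permutation.Setoid.Properties using (Unique-resp-↭)
open import Data.Product using (∃; ∃₂; _×_; _,_; proj₁; proj₂; uncurry)
open import Data.Product.Properties using (≡-dec)
open import Data.Sum using (_⊎_; inj₁; inj₂; [_,_]′)
open import Data.Empty using (⊥-elim)
open import Data.Vec.Functional using (updateAt)
open import Data.Vec.Functional.Properties using (updateAt-updates; updateAt-minimal)
open import Function using (_∘_; const; _⇔_; mk⇔; Equivalence)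
open import Function.Construct.Composition using (_⇔-∘_)
open import Function.Construct.Symmetry using (⇔-sym)
open import Function.Construct.Identity using (⇔-id)
open import Relation.Binary using (DecidableEquality)
open import Relation.Binary.PropositionalEquality
open import Relation.Nullary using (¬_; ¬?; yes; no)
open import Relation.Nullary.Decidable using (Dec; map′; _→-dec_; _×-dec_; _⊎-dec_; decidable-stable)

private variable
  n : ℕ
  A B : Set

Unique-map⇒≡ : {f : A → B} {xs : List A} → Unique (map f xs) →
  ∀ {a b} → a ∈ xs → b ∈ xs → f a ≡ f b → a ≡ b
Unique-map⇒≡ {xs = _ ∷ _} _         (here refl) (here refl) _     = refl
Unique-map⇒≡ {xs = _ ∷ _} (fx∉ ∷ _) (here refl) (there b∈)  fa≡fb = ⊥-elim (All.lookup (map⁻ fx∉) b∈ fa≡fb)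
Unique-map⇒≡ {xs = _ ∷ _} (fx∉ ∷ _) (there a∈)  (here refl) fa≡fb = ⊥-elim (All.lookup (map⁻ fx∉) a∈ (sym fa≡fb))
Unique-map⇒≡ {xs = _ ∷ _} (_ ∷ u)   (there a∈)  (there b∈)  fa≡fb = Unique-map⇒≡ u a∈ b∈ fa≡fb

record Repetition {A B : Set} (f : A → B) (xs : List A) : Set where
  constructor repetition
  field
    pre      : List A
    s₁       : A
    mid      : List A
    s₂       : A
    post     : List A
    split    : xs ≡ (pre ∷ʳ s₁) ++ (mid ∷ʳ s₂) ++ post
    same-key : f s₁ ≡ f s₂

unique⊎repetition : {f : A → B} → DecidableEquality B → (xs : List A) → Unique (map f xs) ⊎ Repetition f xs
unique⊎repetition _≟_ [] = inj₁ []
unique⊎repetition {f = f} _≟_ (x ∷ xs) with any? (λ y → f x ≟ f y) xs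
... | yes found with find found
...   | y , y∈ , fx≡fy with ∈-∃++ y∈
...     | ys , zs , refl = inj₂ (repetition [] x ys y zs (cong (x ∷_) (sym (++-assoc ys (y ∷ []) zs))) fx≡fy)
unique⊎repetition {f = f} _≟_ (x ∷ xs) | no ¬found with unique⊎repetition _≟_ xs
... | inj₁ u = inj₁ (map⁺ (¬Any⇒All¬ xs ¬found) ∷ u)
... | inj₂ (repetition pre s₁ mid s₂ post refl same) = inj₂ (repetition (x ∷ pre) s₁ mid s₂ post refl same)

∷ʳ-nonempty : ∀ (xs : List A) x → 0 <ℕ length (xs ∷ʳ x)
∷ʳ-nonempty []      _ = s≤s z≤n
∷ʳ-nonempty (_ ∷ _) _ = s≤s z≤n

length-middle< : ∀ (xs ys zs : List A) → 0 <ℕ length xs → length ys <ℕ length (xs ++ ys ++ zs)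
length-middle< xs ys zs xs>0 = begin-strict
  length ys                        ≤⟨ m≤m+n (length ys) (length zs) ⟩
  length ys ℕ.+ length zs          ≡⟨ length-++ ys ⟨
  length (ys ++ zs)                <⟨ m<n+m (length (ys ++ zs)) xs>0 ⟩
  length xs ℕ.+ length (ys ++ zs)  ≡⟨ length-++ xs ⟨
  length (xs ++ ys ++ zs)          ∎
  where open ℕₚ.≤-Reasoning

length-outer< : ∀ (xs ys zs : List A) → 0 <ℕ length ys → length (xs ++ zs) <ℕ length (xs ++ ys ++ zs)
length-outer< xs ys zs ys>0 = begin-strict
  length (xs ++ zs)                        ≡⟨ length-++ xs ⟩
  length xs ℕ.+ length zs                  <⟨ ℕₚ.+-monoʳ-< (length xs) (m<n+m (length zs) ys>0) ⟩
  length xs ℕ.+ (length ys ℕ.+ length zs)  ≡⟨ cong (length xs ℕ.+_) (length-++ ys) ⟨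
  length xs ℕ.+ length (ys ++ zs)          ≡⟨ length-++ xs ⟨
  length (xs ++ ys ++ zs)                  ∎
  where open ℕₚ.≤-Reasoning

sum-map-mono : ∀ {f g : A → ℕ} xs → (∀ y → f y ≤ℕ g y) → sum (map f xs) ≤ℕ sum (map g xs)
sum-map-mono []       _   = z≤n
sum-map-mono (y ∷ xs) f≤g = ℕₚ.+-mono-≤ (f≤g y) (sum-map-mono xs f≤g)

sum-map-strict : ∀ {f g : A → ℕ} xs → (∀ y → f y ≤ℕ g y) →
  ∀ {x} → x ∈ xs → f x <ℕ g x → sum (map f xs) <ℕ sum (map g xs)
sum-map-strict (y ∷ xs) f≤g (here refl) fx<gx = ℕₚ.+-mono-<-≤ fx<gx (sum-map-mono xs f≤g)
sum-map-strict (y ∷ xs) f≤g (there x∈) fx<gx = ℕₚ.+-mono-≤-< (f≤g y) (sum-map-strict xs f≤g x∈ fx<gx)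

i-m<i : ∀ i {m} → 0 <ℕ m → i - + m < i
i-m<i i {suc m} _ = subst (i - + suc m <_) (+-identityʳ i) (ℤₚ.+-monoʳ-< i -<+)

telescope : (a b c : ℤ) → c - a ≡ (b - a) + (c - b)
telescope = solve-∀

neg-minus : (a b : ℤ) → - (a - b) ≡ b - a
neg-minus = solve-∀

sub-sum : (a b c : ℤ) → a - (b + c) ≡ (a - b) - c
sub-sum = solve-∀

add-sub-cancel : (a b : ℤ) → (a + b) - a ≡ b
add-sub-cancel = solve-∀

add-sub-comm : (a b c : ℤ) → (a + b) - c ≡ (a - c) + b
add-sub-comm = solve-∀

add-add-comm : (a b c : ℤ) → (a + b) + c ≡ a + (c + b)
add-add-comm = solve-∀

sub-sub-cancel : (a b c : ℤ) → (a - c) - (b - c) ≡ a - b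
sub-sub-cancel = solve-∀

sub-add-comm : (a b c : ℤ) → (a - b) + c ≡ (a + c) - b
sub-add-comm = solve-∀

sub-sub : (a b c : ℤ) → a - (b - c) ≡ (a - b) + c
sub-sub = solve-∀

sub-add-cancel : (a b : ℤ) → (a - b) + b ≡ a
sub-add-cancel = solve-∀

sub-sub-comm : (a b c : ℤ) → (a - b) - c ≡ (a - c) - b
sub-sub-comm = solve-∀

there-and-back : (a : ℤ) → a + (- a + 0ℤ) ≡ 0ℤ
there-and-back = solve-∀

back-and-there : (a : ℤ) → - a + (a + 0ℤ) ≡ 0ℤ
back-and-there = solve-∀

-- Cells

pathEdges : Fin n → List (Fin n) → Fin n → List (Edge n)
pathEdges a []      v = (a , v) ∷ []
pathEdges a (b ∷ r) v = (a , b) ∷ pathEdges b r v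

-- `cellEdges` is computed by a helper local to its definition; the tail of the edge list
-- of a cell with at least two vertices is an application of that helper.
cellEdges-tail : (v a : Fin n) (r : List (Fin n)) → drop 1 (cellEdges (v ∷ a ∷ r)) ≡ pathEdges a r v
cellEdges-tail v a []      = refl
cellEdges-tail v a (b ∷ r) = cong ((a , b) ∷_) (cellEdges-tail v b r)

cellEdges-∷ : (v : Fin n) (vs : List (Fin n)) → cellEdges (v ∷ vs) ≡ pathEdges v vs v
cellEdges-∷ v []      = refl
cellEdges-∷ v (a ∷ r) = cong ((v , a) ∷_) (cellEdges-tail v a r)

sources-pathEdges : (a : Fin n) (r : List (Fin n)) (v : Fin n) → map proj₁ (pathEdges a r v) ≡ a ∷ r
sources-pathEdges a []      v = refl
sources-pathEdges a (b ∷ r) v = cong (a ∷_) (sources-pathEdges b r v)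

targets-pathEdges : (a : Fin n) (r : List (Fin n)) (v : Fin n) → map proj₂ (pathEdges a r v) ≡ r ∷ʳ v
targets-pathEdges a []      v = refl
targets-pathEdges a (b ∷ r) v = cong (b ∷_) (targets-pathEdges b r v)

sources-cellEdges : (c : List (Fin n)) → map proj₁ (cellEdges c) ≡ c
sources-cellEdges []       = refl
sources-cellEdges (v ∷ vs) rewrite cellEdges-∷ v vs = sources-pathEdges v vs v

targets-cellEdges : (v : Fin n) (vs : List (Fin n)) → map proj₂ (cellEdges (v ∷ vs)) ≡ vs ∷ʳ v
targets-cellEdges v vs rewrite cellEdges-∷ v vs = targets-pathEdges v vs v

source∈cell : ∀ (c : List (Fin n)) {e} → e ∈ cellEdges c → proj₁ e ∈ c
source∈cell c e∈ = subst (_ ∈_) (sources-cellEdges c) (∈-map⁺ proj₁ e∈)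

target∈cell : ∀ (c : List (Fin n)) {e} → e ∈ cellEdges c → proj₂ e ∈ c
target∈cell (v ∷ vs) e∈ =
  ∈-resp-↭ (↭-sym (∷↭∷ʳ v vs)) (subst (_ ∈_) (targets-cellEdges v vs) (∈-map⁺ proj₂ e∈))

out-edge : ∀ {c : List (Fin n)} {x} → x ∈ c → ∃ λ y → (x , y) ∈ cellEdges c
out-edge {c = c} x∈ with ∈-map⁻ proj₁ (subst (_ ∈_) (sym (sources-cellEdges c)) x∈)
... | (_ , y) , e∈ , refl = y , e∈

in-edge : ∀ {c : List (Fin n)} {x} → x ∈ c → ∃ λ z → (z , x) ∈ cellEdges c
in-edge {c = v ∷ vs} x∈
  with ∈-map⁻ proj₂ (subst (_ ∈_) (sym (targets-cellEdges v vs)) (∈-resp-↭ (∷↭∷ʳ v vs) x∈))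
... | (z , _) , e∈ , refl = z , e∈

cellEdges-unique : ∀ {c : List (Fin n)} → Unique c → Unique (cellEdges c)
cellEdges-unique {c = c} u = Unique.map⁻ (subst Unique (sym (sources-cellEdges c)) u)

same-target⇒same-edge : ∀ {c : List (Fin n)} → Unique c → ∀ {e e'} →
  e ∈ cellEdges c → e' ∈ cellEdges c → proj₂ e ≡ proj₂ e' → e ≡ e'
same-target⇒same-edge {c = v ∷ vs} u = Unique-map⇒≡ targets-unique
  where
  targets-unique : Unique (map proj₂ (cellEdges (v ∷ vs)))
  targets-unique = subst Unique (sym (targets-cellEdges v vs)) (Unique-resp-↭ (setoid _) (↭⇒↭ₛ (∷↭∷ʳ v vs)) u)

length-cellEdges : (c : List (Fin n)) → length (cellEdges c) ≡ length c
length-cellEdges c = trans (sym (length-map proj₁ (cellEdges c))) (cong length (sources-cellEdges c))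

edgeSum : Flow n → List (Edge n) → ℤ
edgeSum C []       = 0ℤ
edgeSum C (e ∷ es) = C e + edgeSum C es

flux-pathEdges : (C : Flow n) (a : Fin n) (r : List (Fin n)) (v : Fin n) →
  flux C a (map (fwd ,_) (r ∷ʳ v)) ≡ edgeSum C (pathEdges a r v)
flux-pathEdges C a []      v = refl
flux-pathEdges C a (b ∷ r) v = cong (_+_ (C (a , b))) (flux-pathEdges C b r v)

cellFlux≡edgeSum : (C : Flow n) (c : List (Fin n)) → cellFlux C c ≡ edgeSum C (cellEdges c)
cellFlux≡edgeSum C []       = refl
cellFlux≡edgeSum C (v ∷ vs) rewrite cellEdges-∷ v vs = flux-pathEdges C v vs v

-- Walks and fluxes

module _ {E : List (Edge n)} where

  walk-++ : ∀ {x ts y us z} → Walk E x ts y → Walk E y us z → Walk E x (ts ++ us) z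
  walk-++ nil         w = w
  walk-++ (stepF e v) w = stepF e (walk-++ v w)
  walk-++ (stepB e v) w = stepB e (walk-++ v w)

  walk-split : ∀ {x} ts {us z} → Walk E x (ts ++ us) z → ∃ λ y → Walk E x ts y × Walk E y us z
  walk-split []               w           = _ , nil , w
  walk-split ((fwd , _) ∷ ts) (stepF e w) with walk-split ts w
  ... | y , v , v' = y , stepF e v , v'
  walk-split ((bwd , _) ∷ ts) (stepB e w) with walk-split ts w
  ... | y , v , v' = y , stepB e v , v'

  walk-∷ʳ-target : ∀ {x} ts {s : Dir × Fin n} {y} → Walk E x (ts ∷ʳ s) y → proj₂ s ≡ y
  walk-∷ʳ-target []      (stepF _ nil) = refl
  walk-∷ʳ-target []      (stepB _ nil) = refl
  walk-∷ʳ-target (_ ∷ ts) (stepF _ w)  = walk-∷ʳ-target ts w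
  walk-∷ʳ-target (_ ∷ ts) (stepB _ w)  = walk-∷ʳ-target ts w

  flux-++ : (C : Flow n) → ∀ {x ts y} → Walk E x ts y → ∀ us → flux C x (ts ++ us) ≡ flux C x ts + flux C y us
  flux-++ C nil         us = sym (+-identityˡ _)
  flux-++ C (stepF {x = x} {y} e w) us = trans (cong (_+_ (C (x , y))) (flux-++ C w us)) (sym (+-assoc (C (x , y)) _ _))
  flux-++ C (stepB {x = x} {y} e w) us = trans (cong (_+_ (- C (y , x))) (flux-++ C w us)) (sym (+-assoc (- C (y , x)) _ _))

IsPotential : List (Edge n) → Flow n → (Fin n → ℤ) → Set
IsPotential E C φ = ∀ {a b} → (a , b) ∈ E → φ b - φ a ≡ C (a , b)

potential-flux : ∀ {E : List (Edge n)} {C φ} → IsPotential E C φ →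
  ∀ {x ts y} → Walk E x ts y → φ y - φ x ≡ flux C x ts
potential-flux {φ = φ} pot {x} nil = +-inverseʳ (φ x)
potential-flux {φ = φ} pot {x} (stepF {y = y} {z = z} e w) = begin
  φ z - φ x                  ≡⟨ telescope (φ x) (φ y) (φ z) ⟩
  (φ y - φ x) + (φ z - φ y)  ≡⟨ cong₂ _+_ (pot e) (potential-flux {φ = φ} pot w) ⟩
  _ ∎
  where open ≡-Reasoning
potential-flux {C = C} {φ = φ} pot {x} (stepB {y = y} {z = z} e w) = begin
  φ z - φ x                    ≡⟨ telescope (φ x) (φ y) (φ z) ⟩
  (φ y - φ x) + (φ z - φ y)    ≡⟨ cong (_+ (φ z - φ y)) (sym (neg-minus (φ x) (φ y))) ⟩
  - (φ x - φ y) + (φ z - φ y)  ≡⟨ cong₂ (λ d r → - d + r) (pot e) (potential-flux {φ = φ} pot w) ⟩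
  _ ∎
  where open ≡-Reasoning

module ClosedWalks {E : List (Edge n)}
  (loopless : ∀ {u v} → (u , v) ∈ E → u ≢ v)
  (antisymmetric : ∀ {u v} → (u , v) ∈ E → (v , u) ∉ E)
  (C : Flow n) (tension : ∀ x ts → ClosedTravel E x ts → flux C x ts ≡ 0ℤ) where

  simple-closed-flux : ∀ {x ts} → Unique (map proj₂ ts) → Walk E x ts x → flux C x ts ≡ 0ℤ
  simple-closed-flux {ts = _ ∷ _ ∷ _ ∷ _} u w = tension _ _ (w , u , s≤s (s≤s (s≤s z≤n)))
  simple-closed-flux _ nil                      = refl
  simple-closed-flux _ (stepF e nil)            = ⊥-elim (loopless e refl)
  simple-closed-flux _ (stepB e nil)            = ⊥-elim (loopless e refl)
  simple-closed-flux _ (stepF e (stepF e' nil)) = ⊥-elim (antisymmetric e e')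
  simple-closed-flux _ (stepB e (stepB e' nil)) = ⊥-elim (antisymmetric e e')
  simple-closed-flux _ (stepF e (stepB e' nil)) = there-and-back (C _)
  simple-closed-flux _ (stepB e (stepF e' nil)) = back-and-there (C _)

  closed-flux-bounded : ∀ m {x ts} → length ts <ℕ m → Walk E x ts x → flux C x ts ≡ 0ℤ
  closed-flux-bounded (suc m) {x} {ts} len w with unique⊎repetition _≟_ ts
  ... | inj₁ u = simple-closed-flux u w
  ... | inj₂ (repetition pre s₁ mid s₂ post refl same)
    with walk-split (pre ∷ʳ s₁) w
  ... | y , front-walk , rest-walk with walk-split (mid ∷ʳ s₂) rest-walk
  ... | y' , loop-walk , post-walk
    with trans (sym (walk-∷ʳ-target mid loop-walk)) (trans (sym same) (walk-∷ʳ-target pre front-walk))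
  ... | refl = begin
    flux C x (front ++ loop ++ post)                  ≡⟨ flux-++ C front-walk (loop ++ post) ⟩
    flux C x front + flux C y (loop ++ post)          ≡⟨ cong (_+_ (flux C x front)) (flux-++ C loop-walk post) ⟩
    flux C x front + (flux C y loop + flux C y post)  ≡⟨ cong (λ f → flux C x front + (f + flux C y post)) loop-flux ⟩
    flux C x front + (0ℤ + flux C y post)             ≡⟨ cong (_+_ (flux C x front)) (+-identityˡ _) ⟩
    flux C x front + flux C y post                    ≡⟨ flux-++ C front-walk post ⟨
    flux C x (front ++ post)                          ≡⟨ closed-flux-bounded m outer-shorter (walk-++ front-walk post-walk) ⟩
    0ℤ                                                ∎
    where
    open ≡-Reasoning
    front loop : List (Dir × Fin n)
    front = pre ∷ʳ s₁
    loop  = mid ∷ʳ s₂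
    shorter : ∀ {l} → l <ℕ length (front ++ loop ++ post) → l <ℕ m
    shorter l< = <-≤-trans l< (s≤s⁻¹ len)
    outer-shorter : length (front ++ post) <ℕ m
    outer-shorter = shorter (length-outer< front loop post (∷ʳ-nonempty mid s₂))
    loop-flux : flux C y loop ≡ 0ℤ
    loop-flux = closed-flux-bounded m (shorter (length-middle< front loop post (∷ʳ-nonempty pre s₁))) loop-walk

  closed-flux : ∀ {x ts} → Walk E x ts x → flux C x ts ≡ 0ℤ
  closed-flux {ts = ts} = closed-flux-bounded (suc (length ts)) ≤-refl

module Potentials {E : List (Edge n)} (C : Flow n)
  (closed-flux : ∀ {x ts} → Walk E x ts x → flux C x ts ≡ 0ℤ) where

  open DecMembership (_≟_ {n}) using (_∈?_)

  Consistent : List (Fin n) → (Fin n → ℤ) → Set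
  Consistent D φ = ∀ {a ts b} → a ∈ D → b ∈ D → Walk E a ts b → φ b - φ a ≡ flux C a ts

  Saturated : List (Fin n) → Set
  Saturated D = ∀ {a b} → (a , b) ∈ E → a ∈ D ⇔ b ∈ D

  walk-preserves : ∀ {D} → Saturated D → ∀ {a ts b} → Walk E a ts b → a ∈ D ⇔ b ∈ D
  walk-preserves sat nil         = ⇔-id _
  walk-preserves sat (stepF e w) = walk-preserves sat w ⇔-∘ sat e
  walk-preserves sat (stepB e w) = walk-preserves sat w ⇔-∘ ⇔-sym (sat e)

  Adjacent : Fin n → Fin n → Set
  Adjacent a y = (a , y) ∈ E ⊎ (y , a) ∈ E

  same-side? : ∀ D (e : Edge n) → Dec (proj₁ e ∈ D ⇔ proj₂ e ∈ D)
  same-side? D (a , b) = map′ (uncurry mk⇔) (λ eq → Equivalence.to eq , Equivalence.from eq)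
                              ((a ∈? D →-dec b ∈? D) ×-dec (b ∈? D →-dec a ∈? D))

  crossing⊎saturated : ∀ D → (∃₂ λ a y → a ∈ D × y ∉ D × Adjacent a y) ⊎ Saturated D
  crossing⊎saturated D with All.all? (same-side? D) E
  ... | yes sat = inj₂ (All.lookup sat)
  ... | no ¬sat with find (¬All⇒Any¬ (same-side? D) E ¬sat)
  ... | (a , b) , e , a≁b with a ∈? D | b ∈? D
  ... | yes a∈ | no b∉  = inj₁ (a , b , a∈ , b∉ , inj₁ e)
  ... | no a∉  | yes b∈ = inj₁ (b , a , b∈ , a∉ , inj₂ e)
  ... | yes a∈ | yes b∈ = ⊥-elim (a≁b (mk⇔ (const b∈) (const a∈)))
  ... | no a∉  | no b∉  = ⊥-elim (a≁b (mk⇔ (⊥-elim ∘ a∉) (⊥-elim ∘ b∉)))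

  extend : ∀ {D φ a y} → Consistent D φ → a ∈ D → y ∉ D → ∀ {s s'} → Walk E a s y → Walk E y s' a →
    Consistent (y ∷ D) (updateAt φ y (const (φ a + flux C a s)))
  extend {D} {φ} {a} {y} con a∈ y∉ {s} {s'} go back = consistent
    where
    φ' : Fin n → ℤ
    φ' = updateAt φ y (const (φ a + flux C a s))

    φ'-old : ∀ {b} → b ∈ D → φ' b ≡ φ b
    φ'-old b∈ = updateAt-minimal _ y φ (λ { refl → y∉ b∈ })

    round-trip : flux C a s + flux C y s' ≡ 0ℤ
    round-trip = trans (sym (flux-++ C go s')) (closed-flux (walk-++ go back))

    consistent : Consistent (y ∷ D) φ'
    consistent (here refl) (here refl) w = trans (+-inverseʳ (φ' y)) (sym (closed-flux w))
    consistent {ts = ts} (here refl) (there b∈) w = begin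
      φ' _ - φ' y                              ≡⟨ cong₂ _-_ (φ'-old b∈) (updateAt-updates y φ) ⟩
      φ _ - (φ a + flux C a s)                 ≡⟨ sub-sum (φ _) (φ a) (flux C a s) ⟩
      (φ _ - φ a) - flux C a s                 ≡⟨ cong (_- flux C a s) (con a∈ b∈ (walk-++ go w)) ⟩
      flux C a (s ++ ts) - flux C a s          ≡⟨ cong (_- flux C a s) (flux-++ C go ts) ⟩
      (flux C a s + flux C y ts) - flux C a s  ≡⟨ add-sub-cancel (flux C a s) (flux C y ts) ⟩
      flux C y ts                              ∎
      where open ≡-Reasoning
    consistent {a = q} {ts} (there q∈) (here refl) w = begin
      φ' y - φ' q                               ≡⟨ cong₂ _-_ (updateAt-updates y φ) (φ'-old q∈) ⟩
      (φ a + flux C a s) - φ q                  ≡⟨ add-sub-comm (φ a) (flux C a s) (φ q) ⟩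
      (φ a - φ q) + flux C a s                  ≡⟨ cong (_+ flux C a s) (con q∈ a∈ (walk-++ w back)) ⟩
      flux C q (ts ++ s') + flux C a s          ≡⟨ cong (_+ flux C a s) (flux-++ C w s') ⟩
      (flux C q ts + flux C y s') + flux C a s  ≡⟨ add-add-comm (flux C q ts) (flux C y s') (flux C a s) ⟩
      flux C q ts + (flux C a s + flux C y s')  ≡⟨ cong (_+_ (flux C q ts)) round-trip ⟩
      flux C q ts + 0ℤ                          ≡⟨ +-identityʳ _ ⟩
      flux C q ts                               ∎
      where open ≡-Reasoning
    consistent (there a∈) (there b∈) w = trans (cong₂ _-_ (φ'-old b∈) (φ'-old a∈)) (con a∈ b∈ w)

  add-root : ∀ {D φ r} → Consistent D φ → Saturated D → r ∉ D → Consistent (r ∷ D) φ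
  add-root {φ = φ} {r} _ _ _ (here refl) (here refl) w = trans (+-inverseʳ (φ r)) (sym (closed-flux w))
  add-root _   sat r∉ (here refl) (there b∈)  w = ⊥-elim (r∉ (Equivalence.from (walk-preserves sat w) b∈))
  add-root _   sat r∉ (there a∈)  (here refl) w = ⊥-elim (r∉ (Equivalence.to (walk-preserves sat w) a∈))
  add-root con _   _  (there a∈)  (there b∈)  w = con a∈ b∈ w

  adjacent-walks : ∀ {a y} → Adjacent a y → (∃ λ s → Walk E a s y) × (∃ λ s' → Walk E y s' a)
  adjacent-walks (inj₁ e) = (_ , stepF e nil) , (_ , stepB e nil)
  adjacent-walks (inj₂ e) = (_ , stepB e nil) , (_ , stepF e nil)

  Covers : List (Fin n) → List (Fin n) → Set
  Covers D out = ∀ v → v ∈ D ⊎ v ∈ out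

  without : Fin n → List (Fin n) → List (Fin n)
  without y = filter (λ v → ¬? (v ≟ y))

  length-without : ∀ {y out} → y ∈ out → length (without y out) <ℕ length out
  length-without {y} {out} y∈ = filter-notAll (λ v → ¬? (v ≟ y)) out (Any.map (λ { refl v≢y → v≢y refl }) y∈)

  covers-move : ∀ {D out} y → Covers D out → Covers (y ∷ D) (without y out)
  covers-move y cov v with v ≟ y | cov v
  ... | yes refl | _        = inj₁ (here refl)
  ... | no _     | inj₁ v∈  = inj₁ (there v∈)
  ... | no v≢y   | inj₂ v∈  = inj₂ (∈-filter⁺ (λ v → ¬? (v ≟ y)) v∈ v≢y)

  covers-drop : ∀ {D r out} → r ∈ D → Covers D (r ∷ out) → Covers D out
  covers-drop r∈ cov v with cov v
  ... | inj₁ v∈         = inj₁ v∈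
  ... | inj₂ (here refl) = inj₁ r∈
  ... | inj₂ (there v∈) = inj₂ v∈

  WalkPotential : (Fin n → ℤ) → Set
  WalkPotential φ = ∀ {a ts b} → Walk E a ts b → φ b - φ a ≡ flux C a ts

  -- Values are propagated along an edge leaving the consistent part D; once no edge leaves
  -- D it is a union of components, and a vertex still outstanding starts a new one.
  grow : ∀ m D φ out → length out ≤ℕ m → Consistent D φ → Covers D out → ∃ WalkPotential
  grow _       D φ []        _   con cov = φ , con (in-D (cov _)) (in-D (cov _))
    where
    in-D : ∀ {v} → v ∈ D ⊎ v ∈ [] → v ∈ D
    in-D (inj₁ v∈) = v∈
  grow (suc m) D φ (r ∷ out) len con cov with crossing⊎saturated D
  ... | inj₁ (a , y , a∈ , y∉ , adj) = grow-across (proj₂ (proj₁ walks)) (proj₂ (proj₂ walks))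
    where
    walks : (∃ λ s → Walk E a s y) × (∃ λ s' → Walk E y s' a)
    walks = adjacent-walks adj
    y-outstanding : y ∈ r ∷ out
    y-outstanding with cov y
    ... | inj₁ y∈ = ⊥-elim (y∉ y∈)
    ... | inj₂ y∈ = y∈
    grow-across : ∀ {s s'} → Walk E a s y → Walk E y s' a → ∃ WalkPotential
    grow-across {s} go back =
      grow m (y ∷ D) (updateAt φ y (const (φ a + flux C a s))) (without y (r ∷ out))
           (s≤s⁻¹ (<-≤-trans (length-without y-outstanding) len))
           (extend {φ = φ} con a∈ y∉ go back) (covers-move y cov)
  ... | inj₂ sat with r ∈? D
  ... | yes r∈ = grow m D φ out (s≤s⁻¹ len) con (covers-drop r∈ cov)
  ... | no r∉  = grow m (r ∷ D) φ (without r (r ∷ out))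
                      (s≤s⁻¹ (<-≤-trans (length-without {r} {r ∷ out} (here refl)) len))
                      (add-root {φ = φ} con sat r∉) (covers-move r cov)

  walk-potential : ∃ WalkPotential
  walk-potential = grow _ [] (const 0ℤ) (allFin n) ≤-refl (λ ()) (inj₂ ∘ ∈-allFin)

  potential : (ν : Fin n) → ∃ λ φ → φ ν ≡ 0ℤ × IsPotential E C φ
  potential ν with walk-potential
  ... | φ , pot = (λ y → φ y - φ ν) , +-inverseʳ (φ ν) , λ {a} {b} e →
    trans (sub-sub-cancel (φ b) (φ a) (φ ν)) (trans (pot (stepF e nil)) (+-identityʳ _))

-- Tilings and height functions

module _ (P : Polycell n) where
  open Polycell P
  open DecMembership (_≟_ {n}) using () renaming (_∈?_ to _∈ᶠ?_)
  -- `_∈ᵉ?_` is the decision procedure inside `C[_]`, so `with` on it evaluates `C[_]`.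
  open DecMembership (≡-dec (_≟_ {n}) (_≟_ {n})) using () renaming (_∈?_ to _∈ᵉ?_)

  cell-containing : ∀ {e} → e ∈ edgesP P → ∃ λ c → c ∈ cells × e ∈ cellEdges c
  cell-containing e∈ = find (∈-concatMap⁻ cellEdges e∈)

  edge-of-cell : ∀ {c e} → c ∈ cells → e ∈ cellEdges c → e ∈ edgesP P
  edge-of-cell c∈ e∈ = ∈-concatMap⁺ cellEdges (lose c∈ e∈)

  edgesP⊆GE : ∀ {e} → e ∈ edgesP P → e ∈ GE
  edgesP⊆GE e∈ with cell-containing e∈
  ... | _ , c∈ , e∈c = All.lookup cellInG c∈ e∈c

  edgesP-loopless : ∀ {u v} → (u , v) ∈ edgesP P → u ≢ v
  edgesP-loopless = noLoop ∘ edgesP⊆GE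

  edgesP-antisymmetric : ∀ {u v} → (u , v) ∈ edgesP P → (v , u) ∉ edgesP P
  edgesP-antisymmetric e e' = antisym (edgesP⊆GE e) (edgesP⊆GE e')

  source-vertex : ∀ {a b} → (a , b) ∈ edgesP P → VertexP P a
  source-vertex e∈ = Any.map (source∈cell _) (∈-concatMap⁻ cellEdges e∈)

  target-vertex : ∀ {a b} → (a , b) ∈ edgesP P → VertexP P b
  target-vertex e∈ = Any.map (target∈cell _) (∈-concatMap⁻ cellEdges e∈)

  boundary-vertex : ∀ {x} → OnBoundary P x → VertexP P x
  boundary-vertex (_ , inj₁ e∈) = source-vertex (boundary⊆ e∈)
  boundary-vertex (_ , inj₂ e∈) = target-vertex (boundary⊆ e∈)

  vertex? : ∀ x → Dec (VertexP P x)
  vertex? x = any? (x ∈ᶠ?_) cells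

  onBoundary? : ∀ x → Dec (OnBoundary P x)
  onBoundary? x = anyFin? λ y → ((x , y) ∈ᵉ? boundary) ⊎-dec ((y , x) ∈ᵉ? boundary)

  module _ (k : ℕ) where
    open Tiling

    C-tiled : (Q : Tiling P) → ∀ {e} → e ∈ tedges Q → C[_] P k Q e ≡ + 1 - + k
    C-tiled Q {e} e∈ with e ∈ᵉ? tedges Q
    ... | yes _  = refl
    ... | no e∉ = ⊥-elim (e∉ e∈)

    C-untiled : (Q : Tiling P) → ∀ {e} → e ∉ tedges Q → C[_] P k Q e ≡ + 1
    C-untiled Q {e} e∉ with e ∈ᵉ? tedges Q
    ... | yes e∈ = ⊥-elim (e∉ e∈)
    ... | no _  = refl

    C-cong : (Q Q' : Tiling P) → ∀ {e} → (e ∈ tedges Q ⇔ e ∈ tedges Q') → C[_] P k Q e ≡ C[_] P k Q' e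
    C-cong Q Q' {e} same with e ∈ᵉ? tedges Q
    ... | yes e∈ = sym (C-tiled Q' (Equivalence.to same e∈))
    ... | no e∉  = sym (C-untiled Q' (e∉ ∘ Equivalence.from same))

    edgeSum-untiled : (Q : Tiling P) → ∀ {es} → All (_∉ tedges Q) es → edgeSum (C[_] P k Q) es ≡ + length es
    edgeSum-untiled Q []         = refl
    edgeSum-untiled Q (e∉ ∷ es∉) = cong₂ _+_ (C-untiled Q e∉) (edgeSum-untiled Q es∉)

    edgeSum-one-tiled : (Q : Tiling P) → ∀ {es} → Unique es →
      (∀ {e e'} → e ∈ tedges Q → e ∈ es → e' ∈ tedges Q → e' ∈ es → e ≡ e') →
      ∀ {e₀} → e₀ ∈ tedges Q → e₀ ∈ es → edgeSum (C[_] P k Q) es ≡ + length es - + k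
    edgeSum-one-tiled Q {e ∷ es} (e∉es ∷ u) one e₀∈T e₀∈ with e ∈ᵉ? tedges Q
    ... | yes e∈T = begin
      (+ 1 - + k) + edgeSum (C[_] P k Q) es ≡⟨ cong (_+_ (+ 1 - + k)) (edgeSum-untiled Q others-untiled) ⟩
      (+ 1 - + k) + + length es             ≡⟨ sub-add-comm (+ 1) (+ k) (+ length es) ⟩
      + length (e ∷ es) - + k               ∎
      where
      open ≡-Reasoning
      others-untiled : All (_∉ tedges Q) es
      others-untiled = All.tabulate λ e'∈ e'∈T → All.lookup e∉es e'∈ (one e∈T (here refl) e'∈T (there e'∈))
    ... | no e∉T with e₀∈
    ...   | here refl = ⊥-elim (e∉T e₀∈T)
    ...   | there e₀∈es = begin
      + 1 + edgeSum (C[_] P k Q) es         ≡⟨ cong (_+_ (+ 1)) rest-sum ⟩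
      + 1 + (+ length es - + k)             ≡⟨ +-assoc (+ 1) (+ length es) (- + k) ⟨
      + length (e ∷ es) - + k               ∎
      where
      open ≡-Reasoning
      rest-sum : edgeSum (C[_] P k Q) es ≡ + length es - + k
      rest-sum = edgeSum-one-tiled Q u (λ t e∈ t' e'∈ → one t (there e∈) t' (there e'∈)) e₀∈T e₀∈es

    cellFlux-C≡0 : Regular P k → (Q : Tiling P) → All (λ c → cellFlux (C[_] P k Q) c ≡ 0ℤ) cells
    cellFlux-C≡0 regular Q = All.tabulate around
      where
      around : ∀ {c} → c ∈ cells → cellFlux (C[_] P k Q) c ≡ 0ℤ
      around {c} c∈ with All.lookup (cover Q) c∈
      ... | _ , e₀∈T , e₀∈c = begin
        cellFlux (C[_] P k Q) c             ≡⟨ cellFlux≡edgeSum _ c ⟩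
        edgeSum (C[_] P k Q) (cellEdges c)  ≡⟨ edgeSum-one-tiled Q unique (All.lookup (disjoint Q) c∈) e₀∈T e₀∈c ⟩
        + length (cellEdges c) - + k        ≡⟨ cong (λ l → + l - + k) length≡k ⟩
        + k - + k                           ≡⟨ +-inverseʳ (+ k) ⟩
        0ℤ                                  ∎
        where
        open ≡-Reasoning
        unique : Unique (cellEdges c)
        unique = cellEdges-unique (All.lookup cellElementary c∈)
        length≡k : length (cellEdges c) ≡ k
        length≡k = trans (length-cellEdges c) (All.lookup regular c∈)

    height : Regular P k → Contractible P → (ν : Fin n) → (Q : Tiling P) →
      ∃ λ φ → φ ν ≡ 0ℤ × IsPotential (edgesP P) (C[_] P k Q) φ
    height regular (_ , tension⇔cellFlux) ν Q =
      Potentials.potential (C[_] P k Q) (ClosedWalks.closed-flux edgesP-loopless edgesP-antisymmetric _ tension) ν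
      where
      tension : IsTension P (C[_] P k Q)
      tension = proj₂ (tension⇔cellFlux (C[_] P k Q)) (cellFlux-C≡0 regular Q)

    module Flip (Q : Tiling P) {φ : Fin n → ℤ} (pot : IsPotential (edgesP P) (C[_] P k Q) φ)
                {x : Fin n} (x-max : ∀ y → VertexP P y → φ y ≤ φ x) (x∉∂ : ¬ OnBoundary P x) where

      out-tiled : ∀ {y} → (x , y) ∈ edgesP P → (x , y) ∈ tedges Q
      out-tiled {y} e with (x , y) ∈ᵉ? tedges Q
      ... | yes t = t
      ... | no t  = ⊥-elim (+1≰0 (subst (_≤ 0ℤ) (trans (pot e) (C-untiled Q t)) y-x≤0))
        where
        y-x≤0 : φ y - φ x ≤ 0ℤ
        y-x≤0 = i≤j⇒i-j≤0 (x-max y (target-vertex e))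
        +1≰0 : ¬ (+ 1 ≤ 0ℤ)
        +1≰0 (+≤+ ())

      tiled-in-x-cell : ∀ {c e} → c ∈ cells → x ∈ c → e ∈ tedges Q → e ∈ cellEdges c → proj₁ e ≡ x
      tiled-in-x-cell c∈ x∈c e∈T e∈c with out-edge x∈c
      ... | _ , out∈c =
        cong proj₁ (All.lookup (disjoint Q) c∈ e∈T e∈c (out-tiled (edge-of-cell c∈ out∈c)) out∈c)

      in-untiled : ∀ {a} → (a , x) ∈ edgesP P → (a , x) ∉ tedges Q
      in-untiled e e∈T with cell-containing e
      ... | c , c∈ , e∈c = edgesP-loopless e (tiled-in-x-cell c∈ (target∈cell c e∈c) e∈T e∈c)

      not-from-x? : (e : Edge n) → Dec (proj₁ e ≢ x)
      not-from-x? e = ¬? (proj₁ e ≟ x)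

      into-x? : (e : Edge n) → Dec (proj₂ e ≡ x)
      into-x? e = proj₂ e ≟ x

      flipped-edges : List (Edge n)
      flipped-edges = filter not-from-x? (tedges Q) ++ filter into-x? (edgesP P)

      ∈-flipped⁻ : ∀ {e} → e ∈ flipped-edges → (e ∈ tedges Q × proj₁ e ≢ x) ⊎ (e ∈ edgesP P × proj₂ e ≡ x)
      ∈-flipped⁻ e∈ with ∈-++⁻ (filter not-from-x? (tedges Q)) e∈
      ... | inj₁ e∈ˡ = inj₁ (∈-filter⁻ not-from-x? e∈ˡ)
      ... | inj₂ e∈ʳ = inj₂ (∈-filter⁻ into-x? e∈ʳ)

      kept : ∀ {e} → e ∈ tedges Q → proj₁ e ≢ x → e ∈ flipped-edges
      kept e∈ e≁x = ∈-++⁺ˡ (∈-filter⁺ not-from-x? e∈ e≁x)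

      added : ∀ {e} → e ∈ edgesP P → proj₂ e ≡ x → e ∈ flipped-edges
      added e∈ e→x = ∈-++⁺ʳ _ (∈-filter⁺ into-x? e∈ e→x)

      flipped-in-x-cell : ∀ {c e} → c ∈ cells → x ∈ c → e ∈ flipped-edges → e ∈ cellEdges c → proj₂ e ≡ x
      flipped-in-x-cell c∈ x∈c e∈ e∈c with ∈-flipped⁻ e∈
      ... | inj₂ (_ , e→x)   = e→x
      ... | inj₁ (e∈T , e≁x) = ⊥-elim (e≁x (tiled-in-x-cell c∈ x∈c e∈T e∈c))

      flipped-in-other-cell : ∀ {c e} → x ∉ c → e ∈ flipped-edges → e ∈ cellEdges c → e ∈ tedges Q
      flipped-in-other-cell {c} x∉c e∈ e∈c with ∈-flipped⁻ e∈
      ... | inj₁ (e∈T , _)  = e∈T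
      ... | inj₂ (_ , refl) = ⊥-elim (x∉c (target∈cell c e∈c))

      flipped-off-boundary : ∀ {e} → e ∈ flipped-edges → e ∉ boundary
      flipped-off-boundary e∈ with ∈-flipped⁻ e∈
      ... | inj₁ (e∈T , _)  = tedges∂ Q e∈T
      ... | inj₂ (_ , refl) = λ e∈∂ → x∉∂ (_ , inj₂ e∈∂)

      flipped-cover : ∀ {c} → c ∈ cells → ∃ λ e → e ∈ flipped-edges × e ∈ cellEdges c
      flipped-cover {c} c∈ with x ∈ᶠ? c
      ... | yes x∈c = let z , e∈c = in-edge x∈c in (z , x) , added (edge-of-cell c∈ e∈c) refl , e∈c
      ... | no x∉c  = let e , e∈T , e∈c = All.lookup (cover Q) c∈ in
        e , kept e∈T (λ eq → x∉c (subst (_∈ c) eq (source∈cell c e∈c))) , e∈c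

      flipped-disjoint : ∀ {c} → c ∈ cells → ∀ {e e'} → e ∈ flipped-edges → e ∈ cellEdges c →
                         e' ∈ flipped-edges → e' ∈ cellEdges c → e ≡ e'
      flipped-disjoint {c} c∈ e∈ e∈c e'∈ e'∈c with x ∈ᶠ? c
      ... | yes x∈c = same-target⇒same-edge (All.lookup cellElementary c∈) e∈c e'∈c
                        (trans (flipped-in-x-cell c∈ x∈c e∈ e∈c) (sym (flipped-in-x-cell c∈ x∈c e'∈ e'∈c)))
      ... | no x∉c  = All.lookup (disjoint Q) c∈ (flipped-in-other-cell x∉c e∈ e∈c) e∈c
                                                  (flipped-in-other-cell x∉c e'∈ e'∈c) e'∈c

      flipped : Tiling P
      flipped = record
        { tedges   = flipped-edges
        ; tedgesP  = λ e∈ → [ tedgesP Q ∘ proj₁ , proj₁ ]′ (∈-flipped⁻ e∈)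
        ; tedges∂  = flipped-off-boundary
        ; cover    = All.tabulate flipped-cover
        ; disjoint = All.tabulate flipped-disjoint
        }

      lowered : Fin n → ℤ
      lowered = updateAt φ x (_- + k)

      lowered-x : lowered x ≡ φ x - + k
      lowered-x = updateAt-updates x φ

      lowered-≢x : ∀ {y} → y ≢ x → lowered y ≡ φ y
      lowered-≢x y≢x = updateAt-minimal _ x φ y≢x

      lowered≤φ : ∀ y → lowered y ≤ φ y
      lowered≤φ y with y ≟ x
      ... | yes refl = ℤₚ.≤-trans (ℤₚ.≤-reflexive lowered-x) (i-j≤i (φ x) (+ k))
      ... | no y≢x   = ℤₚ.≤-reflexive (lowered-≢x y≢x)

      lowered<φ : 0 <ℕ k → lowered x < φ x
      lowered<φ k>0 = ℤₚ.≤-<-trans (ℤₚ.≤-reflexive lowered-x) (i-m<i (φ x) k>0)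

      lowered-above : ∀ {L} → L ≤ - + k → 0ℤ ≤ φ x → (∀ y → L ≤ φ y) → ∀ y → L ≤ lowered y
      lowered-above {L} L≤-k 0≤φx above y with y ≟ x
      ... | yes refl = ℤₚ.≤-trans L≤-k (ℤₚ.≤-trans -k≤φx-k (ℤₚ.≤-reflexive (sym lowered-x)))
        where
        -k≤φx-k : - + k ≤ φ x - + k
        -k≤φx-k = subst (_≤ φ x - + k) (+-identityˡ (- + k)) (ℤₚ.+-monoˡ-≤ (- + k) 0≤φx)
      ... | no y≢x   = subst (L ≤_) (sym (lowered-≢x y≢x)) (above y)

      lowered-potential-out : ∀ {b} → (x , b) ∈ edgesP P → lowered b - lowered x ≡ C[_] P k flipped (x , b)
      lowered-potential-out {b} e = begin
        lowered b - lowered x  ≡⟨ cong₂ _-_ (lowered-≢x b≢x) lowered-x ⟩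
        φ b - (φ x - + k)      ≡⟨ sub-sub (φ b) (φ x) (+ k) ⟩
        (φ b - φ x) + + k      ≡⟨ cong (_+ + k) (trans (pot e) (C-tiled Q (out-tiled e))) ⟩
        (+ 1 - + k) + + k      ≡⟨ sub-add-cancel (+ 1) (+ k) ⟩
        + 1                    ≡⟨ C-untiled flipped not-flipped ⟨
        C[_] P k flipped (x , b) ∎
        where
        open ≡-Reasoning
        b≢x : b ≢ x
        b≢x = edgesP-loopless e ∘ sym
        not-flipped : (x , b) ∉ flipped-edges
        not-flipped e∈ with ∈-flipped⁻ e∈
        ... | inj₁ (_ , x≢x) = x≢x refl
        ... | inj₂ (_ , b≡x) = b≢x b≡x

      lowered-potential-in : ∀ {a} → (a , x) ∈ edgesP P → lowered x - lowered a ≡ C[_] P k flipped (a , x)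
      lowered-potential-in {a} e = begin
        lowered x - lowered a  ≡⟨ cong₂ _-_ lowered-x (lowered-≢x (edgesP-loopless e)) ⟩
        (φ x - + k) - φ a      ≡⟨ sub-sub-comm (φ x) (+ k) (φ a) ⟩
        (φ x - φ a) - + k      ≡⟨ cong (_- + k) (trans (pot e) (C-untiled Q (in-untiled e))) ⟩
        + 1 - + k              ≡⟨ C-tiled flipped (added e refl) ⟨
        C[_] P k flipped (a , x) ∎
        where open ≡-Reasoning

      lowered-potential-away : ∀ {a b} → (a , b) ∈ edgesP P → a ≢ x → b ≢ x →
        lowered b - lowered a ≡ C[_] P k flipped (a , b)
      lowered-potential-away {a} {b} e a≢x b≢x = begin
        lowered b - lowered a  ≡⟨ cong₂ _-_ (lowered-≢x b≢x) (lowered-≢x a≢x) ⟩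
        φ b - φ a              ≡⟨ pot e ⟩
        C[_] P k Q (a , b)     ≡⟨ C-cong Q flipped (mk⇔ (λ t → kept t a≢x) flipped⇒tiled) ⟩
        C[_] P k flipped (a , b) ∎
        where
        open ≡-Reasoning
        flipped⇒tiled : (a , b) ∈ flipped-edges → (a , b) ∈ tedges Q
        flipped⇒tiled e∈ with ∈-flipped⁻ e∈
        ... | inj₁ (t , _)   = t
        ... | inj₂ (_ , b≡x) = ⊥-elim (b≢x b≡x)

      lowered-potential : IsPotential (edgesP P) (C[_] P k flipped) lowered
      lowered-potential {a} {b} = by-endpoints (a ≟ x) (b ≟ x)
        where
        by-endpoints : Dec (a ≡ x) → Dec (b ≡ x) →
          (a , b) ∈ edgesP P → lowered b - lowered a ≡ C[_] P k flipped (a , b)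
        by-endpoints (yes refl) _          = lowered-potential-out
        by-endpoints (no a≢x)   (yes refl) = lowered-potential-in
        by-endpoints (no a≢x)   (no b≢x) e = lowered-potential-away e a≢x b≢x

module _ {L : ℤ} where

  ∣-∣-above : ∀ {a} → L ≤ a → + ∣ a - L ∣ ≡ a - L
  ∣-∣-above L≤a = 0≤i⇒+∣i∣≡i (i≤j⇒0≤j-i L≤a)

  ∣-∣-mono-≤ : ∀ {a b} → L ≤ a → a ≤ b → ∣ a - L ∣ ≤ℕ ∣ b - L ∣
  ∣-∣-mono-≤ L≤a a≤b =
    drop‿+≤+ (subst₂ _≤_ (sym (∣-∣-above L≤a)) (sym (∣-∣-above L≤b)) (ℤₚ.+-monoˡ-≤ (- L) a≤b))
    where
    L≤b : L ≤ _
    L≤b = ℤₚ.≤-trans L≤a a≤b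

  ∣-∣-mono-< : ∀ {a b} → L ≤ a → a < b → ∣ a - L ∣ <ℕ ∣ b - L ∣
  ∣-∣-mono-< L≤a a<b =
    drop‿+<+ (subst₂ _<_ (sym (∣-∣-above L≤a)) (sym (∣-∣-above L≤b)) (ℤₚ.+-monoˡ-< (- L) a<b))
    where
    L≤b : L ≤ _
    L≤b = ℤₚ.≤-trans L≤a (ℤₚ.<⇒≤ a<b)

  depth : (Fin n → ℤ) → ℕ
  depth {n} φ = sum (map (λ y → ∣ φ y - L ∣) (allFin n))

  depth-decreasing : ∀ {φ ψ : Fin n → ℤ} → (∀ y → L ≤ ψ y) → (∀ y → ψ y ≤ φ y) →
    ∀ x → ψ x < φ x → depth ψ <ℕ depth φ
  depth-decreasing above ψ≤φ x ψx<φx =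
    sum-map-strict (allFin _) (λ y → ∣-∣-mono-≤ (above y) (ψ≤φ y)) (∈-allFin x) (∣-∣-mono-< (above x) ψx<φx)

-- Flipping until the maximum lies on the boundary

module _ {P : Polycell n} {k : ℕ} {ν : Fin n} (ν∈∂ : OnBoundary P ν) (regular : Regular P k) where
  open Polycell P

  IsMaximum : (Fin n → ℤ) → Fin n → Set
  IsMaximum φ x = ∀ y → VertexP P y → φ y ≤ φ x

  interior-maximum? : ∀ φ → Dec (∃ λ x → VertexP P x × IsMaximum φ x × ¬ OnBoundary P x)
  interior-maximum? φ = anyFin? λ x → vertex? P x ×-dec maximum? x ×-dec ¬? (onBoundary? P x)
    where
    maximum? : ∀ x → Dec (IsMaximum φ x)
    maximum? x = allFin? λ y → vertex? P y →-dec (φ y ℤₚ.≤? φ x)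

  k-positive : ∀ {x} → VertexP P x → 0 <ℕ k
  k-positive x∈ with find x∈
  ... | c , c∈ , x∈c = subst (0 <ℕ_) (All.lookup regular c∈) (nonempty x∈c)
    where
    nonempty : ∀ {x} {c : List (Fin n)} → x ∈ c → 0 <ℕ length c
    nonempty (here _)  = s≤s z≤n
    nonempty (there _) = s≤s z≤n

  flip-until-maximal : ∀ m (Q : Tiling P) φ → φ ν ≡ 0ℤ → IsPotential (edgesP P) (C[_] P k Q) φ →
    ∀ {L} → L ≤ - + k → (∀ y → L ≤ φ y) → depth {L} φ <ℕ m → ∃ (Maximal P ν k)
  flip-until-maximal (suc m) Q φ φν pot {L} L≤-k above d< with interior-maximum? φ
  ... | no none = Q , φ , (φν , λ _ _ _ (w , _) → potential-flux {φ = φ} pot w) , maxima-on-boundary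
    where
    maxima-on-boundary : ∀ x → VertexP P x → IsMaximum φ x → OnBoundary P x
    maxima-on-boundary x x∈ x-max =
      decidable-stable (onBoundary? P x) λ x∉∂ → none (x , x∈ , x-max , x∉∂)
  ... | yes (x , x∈ , x-max , x∉∂) =
    flip-until-maximal m flipped lowered lowered-ν lowered-potential L≤-k lowered-above′
      (<-≤-trans (depth-decreasing lowered-above′ lowered≤φ x (lowered<φ (k-positive x∈))) (s≤s⁻¹ d<))
    where
    open Flip P k Q pot x-max x∉∂

    lowered-ν : lowered ν ≡ 0ℤ
    lowered-ν = trans (lowered-≢x (λ { refl → x∉∂ ν∈∂ })) φν

    lowered-above′ : ∀ y → L ≤ lowered y
    lowered-above′ = lowered-above L≤-k (subst (_≤ φ x) φν (x-max ν (boundary-vertex P ν∈∂))) above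

  maximal-tiling : (Q : Tiling P) → (∃ λ φ → φ ν ≡ 0ℤ × IsPotential (edgesP P) (C[_] P k Q) φ) →
    ∃ (Maximal P ν k)
  maximal-tiling Q (φ , φν , pot) =
    flip-until-maximal (suc (depth {L} φ)) Q φ φν pot (min≤⊤ (- + k) heights) above ℕₚ.≤-refl
    where
    heights : List ℤ
    heights = map φ (allFin n)
    L : ℤ
    L = min (- + k) heights
    above : ∀ y → L ≤ φ y
    above y = All.lookup (min≤xs (- + k) heights) (∈-map⁺ φ (∈-allFin y))

lemma2 : ∀ {n : ℕ} (P : Polycell n) (k : ℕ) (ν : Fin n) →
    OnBoundary P ν → Regular P k → Tilable P → Contractible P →
    ∃ λ (Q : Tiling P) → Maximal P ν k Q
lemma2 P k ν ν∈∂ regular Q₀ contractible =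
  maximal-tiling ν∈∂ regular Q₀ (height P k regular contractible ν Q₀)
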